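{- Let $n$ be a positive integer. Let $d=a(b+c)=ab+ac$ and define blocks $L_1,\dots,L_{2n}$ by $L_j=c$ for $j$ odd, $L_j=d$ for $j$ even. For $0\le i\le 2n$ put $S_i=L_{i+1}\star\cdots\star L_{2n}$, and $P_i=L_1\star\cdots\star L_i$ if $i$ is odd, $P_i=L_i\star L_{i-1}\star\cdots\star L_1$ if $i$ is even (empty product $=\mathbf 1$). Then $$\sum_{i=0}^{2n}(-1)^i\,P_i*S_i=(-1)^n\,(a^2(b+c))^n,$$ where the right side is an ordinary concatenation power in $\mathfrak A$.
   Context: $\mathfrak A=\mathbb Q\langle a,b,c\rangle$ is the free noncommutative polynomial algebra over $\mathbb Q$ on letters $a,b,c$; $\mathbf 1$ is the empty word. For $k\ge1$ put $\beta_k=a^{k-1}b$, $\gamma_k=a^{k-1}c$. $\mathfrak A^1$ is the $\mathbb Q$-span of words not ending in $a$; each such word factors uniquely as a product of $\beta_k$'s and $\gamma_k$'s. Stuffle product $*$ on $\mathfrak A^1$: define linear maps $M_{\beta_k}=\mathrm{id}$ and $M_{\gamma_k}=$ the algebra automorphism swapping letters $b$ and $c$ (fixing $a$). Define $[\beta_m,\beta_n]=[\gamma_m,\gamma_n]=\beta_{m+n}$, $[\beta_m,\gamma_n]=[\gamma_m,\beta_n]=\gamma_{m+n}$. Then $*$ is bilinear, $\mathbf 1*w=w*\mathbf 1=w$, and for $x,y\in\{\beta_k,\gamma_k:k\ge1\}$ and words $w_1,w_2\in\mathfrak A^1$: $xw_1*yw_2=x\,M_x\big(M_x(w_1)*yw_2\big)+y\,M_y\big(xw_1*M_y(w_2)\big)+[x,y]\,M_{[x,y]}\big(M_x(w_1)*M_y(w_2)\big)$.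 $\star$-concatenation: for words $u,v$, if $u$ ends in $b$ and $v=bv'$ then $u\star v=ucv'$; if $u$ ends in $c$ and $v=cv'$ then $u\star v=ubv'$; otherwise $u\star v=uv$. Extend bilinearly; iterated $\star$-products are evaluated left to right. -}

module Defs where

open import Data.Nat using (ℕ; zero; suc; _+_; _∸_)
open import Data.Bool using (Bool; true; false; _∧_; if_then_else_)
open import Data.List using (List; []; _∷_; _++_; map; concatMap; length; replicate; foldl; foldr; reverse)
open import Data.Maybe using (Maybe; just; nothing)
open import Relation.Binary.PropositionalEquality using (_≡_)
open import Data.Product using (_×_; _,_)
open import Data.Rational using (ℚ; 0ℚ; 1ℚ) renaming (_+_ to _+ℚ_; _*_ to _*ℚ_; -_ to -ℚ_)

data Letter : Set where
  a b c : Letter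

Word : Set
Word = List Letter

letterEq : Letter → Letter → Bool
letterEq a a = true
letterEq b b = true
letterEq c c = true
letterEq _ _ = false

wordEq : Word → Word → Bool
wordEq [] [] = true
wordEq (x ∷ u) (y ∷ v) = letterEq x y ∧ wordEq u v
wordEq _ _ = false

-- Elements of 𝔄: finite formal ℚ-linear combinations of words.
-- Two representations are equal in 𝔄 iff all coefficients agree.

Poly : Set
Poly = List (ℚ × Word)

coeff : Poly → Word → ℚ
coeff [] w = 0ℚ
coeff ((q , u) ∷ p) w = (if wordEq u w then q else 0ℚ) +ℚ coeff p w

infix 4 _≈P_
_≈P_ : Poly → Poly → Set
p ≈P q = ∀ w → coeff p w ≡ coeff q w

one : Poly
one = (1ℚ , []) ∷ []

word : Word → Poly
word w = (1ℚ , w) ∷ []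

_⊕_ : Poly → Poly → Poly
p ⊕ q = p ++ q

scale : ℚ → Poly → Poly
scale r p = map (λ { (q , u) → (r *ℚ q , u) }) p

mapW : (Word → Word) → Poly → Poly
mapW f p = map (λ { (q , u) → (q , f u) }) p

bilin : (Word → Word → Poly) → Poly → Poly → Poly
bilin op p q = concatMap (λ { (r , u) → concatMap (λ { (s , v) → scale (r *ℚ s) (op u v) }) q }) p

_·_ : Poly → Poly → Poly
_·_ = bilin (λ u v → word (u ++ v))

_^·_ : Poly → ℕ → Poly
p ^· zero = one
p ^· suc n = p · (p ^· n)

sgn : ℕ → ℚ
sgn zero = 1ℚ
sgn (suc i) = -ℚ (sgn i)

swapL : Letter → Letter
swapL a = a
swapL b = c
swapL c = b

swapW : Word → Word
swapW = map swapL

-- M_x for a block x = a^m l (l ∈ {b,c}): identity if l = b, swap if l = c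
Mw : Letter → Word → Word
Mw c w = swapW w
Mw _ w = w

Mp : Letter → Poly → Poly
Mp l = mapW (Mw l)

-- split off the first block β_{m+1} = a^m b or γ_{m+1} = a^m c
split : Word → Maybe (ℕ × Letter × Word)
split [] = nothing
split (a ∷ w) with split w
... | just (m , l , r) = just (suc m , l , r)
... | nothing = nothing
split (b ∷ w) = just (0 , b , w)
split (c ∷ w) = just (0 , c , w)

blockW : ℕ → Letter → Word
blockW m l = replicate m a ++ (l ∷ [])

-- letter of [x,y]: b if the letters agree, c otherwise
brL : Letter → Letter → Letter
brL b b = b
brL c c = b
brL _ _ = c

prepend : Word → Poly → Poly
prepend x = mapW (x ++_)

-- stuffle on words, with fuel (fuel ≥ total length always suffices,
-- since each recursive call decreases the total length)
stF : ℕ → Word → Word → Poly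
stF zero _ _ = []
stF (suc f) [] v = word v
stF (suc f) (x₀ ∷ u₀) [] = word (x₀ ∷ u₀)
stF (suc f) (x₀ ∷ u₀) (y₀ ∷ v₀) with split (x₀ ∷ u₀) | split (y₀ ∷ v₀)
... | just (m , l , w₁) | just (m' , l' , w₂) =
      prepend (blockW m l) (Mp l (stF f (Mw l w₁) (y₀ ∷ v₀)))
    ⊕ (prepend (blockW m' l') (Mp l' (stF f (x₀ ∷ u₀) (Mw l' w₂)))
    ⊕ prepend (blockW (suc (m + m')) (brL l l'))
              (Mp (brL l l') (stF f (Mw l w₁) (Mw l' w₂))))
... | _ | _ = []   -- words ending in a: outside 𝔄¹, never used

stW : Word → Word → Poly
stW u v = stF (suc (length u + length v)) u v

_✱_ : Poly → Poly → Poly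
_✱_ = bilin stW

lastL : Word → Maybe Letter
lastL [] = nothing
lastL (x ∷ []) = just x
lastL (x ∷ y ∷ w) = lastL (y ∷ w)

starW : Word → Word → Word
starW u v with lastL u | v
... | just b | b ∷ v' = u ++ (c ∷ v')
... | just c | c ∷ v' = u ++ (b ∷ v')
... | _ | _ = u ++ v

_⋆_ : Poly → Poly → Poly
_⋆_ = bilin (λ u v → word (starW u v))

⋆prod : List Poly → Poly
⋆prod [] = one
⋆prod (x ∷ xs) = foldl _⋆_ x xs

dP : Poly
dP = (1ℚ , a ∷ b ∷ []) ∷ (1ℚ , a ∷ c ∷ []) ∷ []

cP : Poly
cP = word (c ∷ [])

odd : ℕ → Bool
odd zero = false
odd (suc n) = if odd n then false else true

L : ℕ → Poly
L j = if odd j then cP else dP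

range : ℕ → ℕ → List Poly
range from zero = []
range from (suc len) = L from ∷ range (suc from) len

S : ℕ → ℕ → Poly
S m i = ⋆prod (range (suc i) (m ∸ i))

P : ℕ → Poly
P i = if odd i then ⋆prod (range 1 i) else ⋆prod (reverse (range 1 i))

sumP : ℕ → (ℕ → Poly) → Poly
sumP zero f = f 0
sumP (suc m) f = sumP m f ⊕ f (suc m)

LHS : ℕ → Poly
LHS n = sumP (n + n) (λ i → scale (sgn i) (P i ✱ S (n + n) i))

a²[b+c] : Poly
a²[b+c] = (1ℚ , a ∷ a ∷ b ∷ []) ∷ (1ℚ , a ∷ a ∷ c ∷ []) ∷ []

RHS : ℕ → Poly
RHS n = scale (sgn n) (a²[b+c] ^· n)

module Submission where

-- A formal combination p is paired with test functions h : Word → ℚ by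
-- ⟪ p ∣ h ⟫ = Σ r·h(u); pairing with the indicator of a word w gives the
-- coefficient of w, so it suffices to show that both sides pair equally with
-- every h.  Under this pairing a twisted prefix p ↦ x·M_x(p) becomes
-- precomposition of h, and the stuffle recursion becomes a recursion on test
-- functions.

open import Defs
open import Data.Nat using (ℕ; zero; suc; pred; _∸_; _≤_; _<_; z≤n; s≤s; _≥_) renaming (_+_ to _+ℕ_)
import Data.Nat.Properties as ℕP
open import Data.List using (List; []; _∷_; _++_; concatMap; length; foldl; reverse; _∷ʳ_)
open import Data.List.Properties using (length-map; map-++; ++-assoc; ++-identityʳ; unfold-reverse)
open import Data.Maybe using (just; nothing)
open import Data.Bool using (Bool; true; false; not; _xor_; if_then_else_)
open import Data.Bool.Properties using (not-involutive; not-distribˡ-xor; xor-same)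
open import Data.Product using (_×_; _,_; ∃)
open import Data.Sum using (_⊎_; inj₁; inj₂)
open import Data.Rational using (ℚ; 0ℚ; 1ℚ; _+_; _*_; -_)
import Data.Rational.Properties as ℚP
open import Data.Rational.Solver using (module +-*-Solver)
open +-*-Solver using (solve; _:=_; _:+_; _:*_; :-_; con)
open import Relation.Binary.PropositionalEquality

⟪_∣_⟫ : Poly → (Word → ℚ) → ℚ
⟪ [] ∣ h ⟫ = 0ℚ
⟪ (r , u) ∷ p ∣ h ⟫ = r * h u + ⟪ p ∣ h ⟫

pair-⊕ : ∀ p q h → ⟪ p ⊕ q ∣ h ⟫ ≡ ⟪ p ∣ h ⟫ + ⟪ q ∣ h ⟫
pair-⊕ [] q h = sym (ℚP.+-identityˡ _)
pair-⊕ ((r , u) ∷ p) q h =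
  trans (cong (r * h u +_) (pair-⊕ p q h)) (sym (ℚP.+-assoc (r * h u) ⟪ p ∣ h ⟫ ⟪ q ∣ h ⟫))

pair-scale : ∀ s p h → ⟪ scale s p ∣ h ⟫ ≡ s * ⟪ p ∣ h ⟫
pair-scale s [] h = sym (ℚP.*-zeroʳ s)
pair-scale s ((r , u) ∷ p) h =
  trans (cong ((s * r) * h u +_) (pair-scale s p h))
        (solve 4 (λ s r x y → (s :* r) :* x :+ s :* y := s :* (r :* x :+ y)) refl s r (h u) ⟪ p ∣ h ⟫)

pair-mapW : ∀ f p h → ⟪ mapW f p ∣ h ⟫ ≡ ⟪ p ∣ (λ w → h (f w)) ⟫
pair-mapW f [] h = refl
pair-mapW f ((r , u) ∷ p) h = cong (r * h (f u) +_) (pair-mapW f p h)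

pair-word : ∀ w h → ⟪ word w ∣ h ⟫ ≡ h w
pair-word w h = trans (ℚP.+-identityʳ _) (ℚP.*-identityˡ _)

pair-cong : ∀ p {h g} → (∀ u → h u ≡ g u) → ⟪ p ∣ h ⟫ ≡ ⟪ p ∣ g ⟫
pair-cong [] e = refl
pair-cong ((r , u) ∷ p) e = cong₂ (λ x y → r * x + y) (e u) (pair-cong p e)

pair-+ : ∀ p h g → ⟪ p ∣ (λ u → h u + g u) ⟫ ≡ ⟪ p ∣ h ⟫ + ⟪ p ∣ g ⟫
pair-+ [] h g = sym (ℚP.+-identityˡ _)
pair-+ ((r , u) ∷ p) h g =
  trans (cong (r * (h u + g u) +_) (pair-+ p h g))
        (solve 5 (λ r x y l m → r :* (x :+ y) :+ (l :+ m) := (r :* x :+ l) :+ (r :* y :+ m))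
               refl r (h u) (g u) ⟪ p ∣ h ⟫ ⟪ p ∣ g ⟫)

pair-bilin : ∀ (mul : Word → Word → Poly) p q h →
  ⟪ bilin mul p q ∣ h ⟫ ≡ ⟪ p ∣ (λ u → ⟪ q ∣ (λ v → ⟪ mul u v ∣ h ⟫) ⟫) ⟫
pair-bilin mul [] q h = refl
pair-bilin mul ((r , u) ∷ p) q h =
  trans (pair-⊕ (concatMap _ q) (bilin mul p q) h)
        (cong₂ _+_ (row _ q (λ s v → refl)) (pair-bilin mul p q h))
  where
  row : ∀ (F : ℚ × Word → Poly) q → (∀ s v → F (s , v) ≡ scale (r * s) (mul u v)) →
        ⟪ concatMap F q ∣ h ⟫ ≡ r * ⟪ q ∣ (λ v → ⟪ mul u v ∣ h ⟫) ⟫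
  row F [] e = sym (ℚP.*-zeroʳ r)
  row F ((s , v) ∷ q) e =
    trans (pair-⊕ (F (s , v)) (concatMap F q) h)
    (trans (cong₂ _+_ (trans (cong ⟪_∣ h ⟫ (e s v)) (pair-scale (r * s) (mul u v) h)) (row F q e))
           (solve 4 (λ r s x y → (r :* s) :* x :+ r :* y := r :* (s :* x :+ y))
                  refl r s ⟪ mul u v ∣ h ⟫ ⟪ q ∣ (λ v → ⟪ mul u v ∣ h ⟫) ⟫))

δ : Word → Word → ℚ
δ w u = if wordEq u w then 1ℚ else 0ℚ

coeff-pair : ∀ p w → coeff p w ≡ ⟪ p ∣ δ w ⟫
coeff-pair [] w = refl
coeff-pair ((q , u) ∷ p) w with wordEq u w
... | true = cong₂ _+_ (sym (ℚP.*-identityʳ q)) (coeff-pair p w)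
... | false = cong₂ _+_ (sym (ℚP.*-zeroʳ q)) (coeff-pair p w)

pair-two : ∀ u v h → ⟪ (1ℚ , u) ∷ (1ℚ , v) ∷ [] ∣ h ⟫ ≡ h u + h v
pair-two u v h = solve 2 (λ x y → con 1ℚ :* x :+ (con 1ℚ :* y :+ con 0ℚ) := x :+ y) refl (h u) (h v)

pair-· : ∀ p q h → ⟪ p · q ∣ h ⟫ ≡ ⟪ p ∣ (λ u → ⟪ q ∣ (λ v → h (u ++ v)) ⟫) ⟫
pair-· p q h = trans (pair-bilin (λ u v → word (u ++ v)) p q h)
  (pair-cong p (λ u → pair-cong q (λ v → pair-word (u ++ v) h)))

pair-⋆ : ∀ p q h → ⟪ p ⋆ q ∣ h ⟫ ≡ ⟪ p ∣ (λ u → ⟪ q ∣ (λ v → h (starW u v)) ⟫) ⟫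
pair-⋆ p q h = trans (pair-bilin (λ u v → word (starW u v)) p q h)
  (pair-cong p (λ u → pair-cong q (λ v → pair-word (starW u v) h)))

odd-suc : ∀ n → odd (suc n) ≡ not (odd n)
odd-suc n with odd n
... | true = refl
... | false = refl

odd-+ : ∀ i r → odd (i +ℕ r) ≡ odd i xor odd r
odd-+ zero r = refl
odd-+ (suc i) r =
  trans (odd-suc (i +ℕ r))
  (trans (cong not (odd-+ i r))
  (trans (not-distribˡ-xor (odd i) (odd r)) (cong (_xor odd r) (sym (odd-suc i)))))

odd-ss : ∀ n → odd (suc (suc n)) ≡ odd n
odd-ss n = trans (odd-suc (suc n)) (trans (cong not (odd-suc n)) (not-involutive (odd n)))

odd-double : ∀ n → odd (n +ℕ n) ≡ false
odd-double n = trans (odd-+ n n) (xor-same (odd n))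

same-parity : ∀ i r → odd (i +ℕ r) ≡ false → odd i ≡ odd r
same-parity i r e = xor-false (odd i) (odd r) (trans (sym (odd-+ i r)) e)
  where
  xor-false : ∀ x y → x xor y ≡ false → x ≡ y
  xor-false false false _ = refl
  xor-false true true _ = refl
  xor-false false true ()
  xor-false true false ()

odd-2k+1 : ∀ k → odd (suc (k +ℕ k)) ≡ true
odd-2k+1 k = trans (odd-suc (k +ℕ k)) (cong not (odd-double k))

odd-2k+2 : ∀ k → odd (suc (suc (k +ℕ k))) ≡ false
odd-2k+2 k = trans (odd-ss (k +ℕ k)) (odd-double k)

even-or-odd : ∀ i → ∃ (λ k → i ≡ k +ℕ k ⊎ i ≡ suc (k +ℕ k))
even-or-odd zero = 0 , inj₁ refl
even-or-odd (suc i) with even-or-odd i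
... | k , inj₁ e = k , inj₂ (cong suc e)
... | k , inj₂ e = suc k , inj₁ (trans (cong suc e) (cong suc (sym (ℕP.+-suc k k))))

swap-inv : ∀ w → swapW (swapW w) ≡ w
swap-inv [] = refl
swap-inv (a ∷ w) = cong (a ∷_) (swap-inv w)
swap-inv (b ∷ w) = cong (b ∷_) (swap-inv w)
swap-inv (c ∷ w) = cong (c ∷_) (swap-inv w)

swap-++ : ∀ u v → swapW (u ++ v) ≡ swapW u ++ swapW v
swap-++ = map-++ swapL

length-Mw : ∀ l w → length (Mw l w) ≡ length w
length-Mw a w = refl
length-Mw b w = refl
length-Mw c w = length-map swapL w

-- Removing the first block (and twisting the rest) makes a word strictly shorter;
-- this is why the fuel-bounded recursion defining stW never runs dry.
split-shortens : ∀ w {m l r} → split w ≡ just (m , l , r) → ∀ l' → length (Mw l' r) < length w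
split-shortens [] () l'
split-shortens (a ∷ w) e l' with split w in e'
split-shortens (a ∷ w) refl l' | just (m , l , r) = ℕP.m<n⇒m<1+n (split-shortens w e' l')
split-shortens (a ∷ w) () l' | nothing
split-shortens (b ∷ w) refl l' = subst (_< suc (length w)) (sym (length-Mw l' w)) (ℕP.n<1+n (length w))
split-shortens (c ∷ w) refl l' = subst (_< suc (length w)) (sym (length-Mw l' w)) (ℕP.n<1+n (length w))

shrinkˡ : ∀ {x' x y f} → x' < x → x +ℕ y < suc f → x' +ℕ y < f
shrinkˡ {y = y} lt p = ℕP.<-≤-trans (ℕP.+-monoˡ-< y lt) (ℕP.≤-pred p)

shrinkʳ : ∀ {x y' y f} → y' < y → x +ℕ y < suc f → x +ℕ y' < f
shrinkʳ {x = x} lt p = ℕP.<-≤-trans (ℕP.+-monoʳ-< x lt) (ℕP.≤-pred p)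

shrink² : ∀ {x' x y' y f} → x' < x → y' < y → x +ℕ y < suc f → x' +ℕ y' < f
shrink² lt lt' p = ℕP.<-≤-trans (ℕP.+-mono-< lt lt') (ℕP.≤-pred p)

stF-fuel : ∀ f g u v → length u +ℕ length v < f → length u +ℕ length v < g → stF f u v ≡ stF g u v
stF-fuel (suc f) (suc g) [] v p q = refl
stF-fuel (suc f) (suc g) (x ∷ u) [] p q = refl
stF-fuel (suc f) (suc g) (x ∷ u) (y ∷ v) p q with split (x ∷ u) in e | split (y ∷ v) in e'
... | just (m , l , w₁) | just (m' , l' , w₂) =
  cong₂ _⊕_
    (cong (λ z → prepend (blockW m l) (Mp l z))
      (stF-fuel f g (Mw l w₁) (y ∷ v) (shrinkˡ (≪ l) p) (shrinkˡ (≪ l) q)))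
    (cong₂ _⊕_
      (cong (λ z → prepend (blockW m' l') (Mp l' z))
        (stF-fuel f g (x ∷ u) (Mw l' w₂) (shrinkʳ (≪' l') p) (shrinkʳ (≪' l') q)))
      (cong (λ z → prepend (blockW (suc (m +ℕ m')) (brL l l')) (Mp (brL l l') z))
        (stF-fuel f g (Mw l w₁) (Mw l' w₂) (shrink² (≪ l) (≪' l') p) (shrink² (≪ l) (≪' l') q))))
  where
  ≪ : ∀ l'' → length (Mw l'' w₁) < length (x ∷ u)
  ≪ = split-shortens (x ∷ u) e
  ≪' : ∀ l'' → length (Mw l'' w₂) < length (y ∷ v)
  ≪' = split-shortens (y ∷ v) e'
... | just _ | nothing = refl
... | nothing | _ = refl

stF-stW : ∀ f u v → length u +ℕ length v < f → stF f u v ≡ stW u v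
stF-stW f u v p = stF-fuel f (suc (length u +ℕ length v)) u v p ℕP.≤-refl

stW-unfold : ∀ u v {m l w₁ m' l' w₂} → split u ≡ just (m , l , w₁) → split v ≡ just (m' , l' , w₂) →
  stW u v ≡ prepend (blockW m l) (Mp l (stW (Mw l w₁) v))
          ⊕ (prepend (blockW m' l') (Mp l' (stW u (Mw l' w₂)))
          ⊕ prepend (blockW (suc (m +ℕ m')) (brL l l')) (Mp (brL l l') (stW (Mw l w₁) (Mw l' w₂))))
stW-unfold [] v () e'
stW-unfold (x ∷ u) [] e ()
stW-unfold (x ∷ u) (y ∷ v) {m} {l} {w₁} {m'} {l'} {w₂} e e' rewrite e | e' =
  cong₂ _⊕_
    (cong (λ z → prepend (blockW m l) (Mp l z))
      (stF-stW _ (Mw l w₁) (y ∷ v) (shrinkˡ (≪ l) ℕP.≤-refl)))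
    (cong₂ _⊕_
      (cong (λ z → prepend (blockW m' l') (Mp l' z))
        (stF-stW _ (x ∷ u) (Mw l' w₂) (shrinkʳ (≪' l') ℕP.≤-refl)))
      (cong (λ z → prepend (blockW (suc (m +ℕ m')) (brL l l')) (Mp (brL l l') z))
        (stF-stW _ (Mw l w₁) (Mw l' w₂) (shrink² (≪ l) (≪' l') ℕP.≤-refl))))
  where
  ≪ : ∀ l'' → length (Mw l'' w₁) < length (x ∷ u)
  ≪ = split-shortens (x ∷ u) e
  ≪' : ∀ l'' → length (Mw l'' w₂) < length (y ∷ v)
  ≪' = split-shortens (y ∷ v) e'

stW-nil : ∀ u → stW u [] ≡ word u
stW-nil [] = refl
stW-nil (x ∷ u) = refl

-- Transpose of p ↦ x·M_l(p): precompose the test function with t ↦ x ++ M_l(t).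
prefixT : Word → Letter → (Word → ℚ) → Word → ℚ
prefixT x l h t = h (x ++ Mw l t)

pair-prefix : ∀ x l p h → ⟪ prepend x (Mp l p) ∣ h ⟫ ≡ ⟪ p ∣ prefixT x l h ⟫
pair-prefix x l p h = trans (pair-mapW (x ++_) (Mp l p) h) (pair-mapW (Mw l) p (λ t → h (x ++ t)))

⟪_✶_∣_⟫ : Word → Word → (Word → ℚ) → ℚ
⟪ u ✶ v ∣ h ⟫ = ⟪ stW u v ∣ h ⟫

pair-unfold : ∀ u v {m l w₁ m' l' w₂} → split u ≡ just (m , l , w₁) → split v ≡ just (m' , l' , w₂) → ∀ h →
  ⟪ u ✶ v ∣ h ⟫ ≡ ⟪ Mw l w₁ ✶ v ∣ prefixT (blockW m l) l h ⟫
               + (⟪ u ✶ Mw l' w₂ ∣ prefixT (blockW m' l') l' h ⟫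
               + ⟪ Mw l w₁ ✶ Mw l' w₂ ∣ prefixT (blockW (suc (m +ℕ m')) (brL l l')) (brL l l') h ⟫)
pair-unfold u v {m} {l} {w₁} {m'} {l'} {w₂} e e' h =
  trans (cong ⟪_∣ h ⟫ (stW-unfold u v e e'))
  (trans (pair-⊕ A (B ⊕ C) h)
  (cong₂ _+_ (pair-prefix (blockW m l) l (stW (Mw l w₁) v) h)
    (trans (pair-⊕ B C h)
      (cong₂ _+_ (pair-prefix (blockW m' l') l' (stW u (Mw l' w₂)) h)
                 (pair-prefix (blockW (suc (m +ℕ m')) (brL l l')) (brL l l') (stW (Mw l w₁) (Mw l' w₂)) h)))))
  where
  A B C : Poly
  A = prepend (blockW m l) (Mp l (stW (Mw l w₁) v))
  B = prepend (blockW m' l') (Mp l' (stW u (Mw l' w₂)))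
  C = prepend (blockW (suc (m +ℕ m')) (brL l l')) (Mp (brL l l') (stW (Mw l w₁) (Mw l' w₂)))

unfold-ab-c : ∀ w v h → ⟪ a ∷ b ∷ w ✶ c ∷ swapW v ∣ h ⟫ ≡
     ⟪ w ✶ c ∷ swapW v ∣ (λ t → h (a ∷ b ∷ t)) ⟫
  + (⟪ a ∷ b ∷ w ✶ v ∣ (λ t → h (c ∷ swapW t)) ⟫ + ⟪ w ✶ v ∣ (λ t → h (a ∷ a ∷ c ∷ swapW t)) ⟫)
unfold-ab-c w v h with pair-unfold (a ∷ b ∷ w) (c ∷ swapW v) refl refl h
... | e rewrite swap-inv v = e

unfold-ac-c : ∀ w v h → ⟪ a ∷ c ∷ swapW w ✶ c ∷ swapW v ∣ h ⟫ ≡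
     ⟪ w ✶ c ∷ swapW v ∣ (λ t → h (a ∷ c ∷ swapW t)) ⟫
  + (⟪ a ∷ c ∷ swapW w ✶ v ∣ (λ t → h (c ∷ swapW t)) ⟫ + ⟪ w ✶ v ∣ (λ t → h (a ∷ a ∷ b ∷ t)) ⟫)
unfold-ac-c w v h with pair-unfold (a ∷ c ∷ swapW w) (c ∷ swapW v) refl refl h
... | e rewrite swap-inv v | swap-inv w = e

unfold-c-ab : ∀ w v h → ⟪ c ∷ swapW w ✶ a ∷ b ∷ v ∣ h ⟫ ≡
     ⟪ w ✶ a ∷ b ∷ v ∣ (λ t → h (c ∷ swapW t)) ⟫
  + (⟪ c ∷ swapW w ✶ v ∣ (λ t → h (a ∷ b ∷ t)) ⟫ + ⟪ w ✶ v ∣ (λ t → h (a ∷ a ∷ c ∷ swapW t)) ⟫)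
unfold-c-ab w v h with pair-unfold (c ∷ swapW w) (a ∷ b ∷ v) refl refl h
... | e rewrite swap-inv w = e

unfold-c-ac : ∀ w v h → ⟪ c ∷ swapW w ✶ a ∷ c ∷ swapW v ∣ h ⟫ ≡
     ⟪ w ✶ a ∷ c ∷ swapW v ∣ (λ t → h (c ∷ swapW t)) ⟫
  + (⟪ c ∷ swapW w ✶ v ∣ (λ t → h (a ∷ c ∷ swapW t)) ⟫ + ⟪ w ✶ v ∣ (λ t → h (a ∷ a ∷ b ∷ t)) ⟫)
unfold-c-ac w v h with pair-unfold (c ∷ swapW w) (a ∷ c ∷ swapW v) refl refl h
... | e rewrite swap-inv w | swap-inv v = e

-- Transposes of p ↦ Σ x·M_x(p) over the blocks x of
--   τc : c;   τd : ab, ac (the two blocks of d);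
--   τcd : aab, aac, i.e. the brackets [c,ac] = β₃ and [c,ab] = γ₃ of c with d.
τc τd τcd : (Word → ℚ) → Word → ℚ
τc g w = g (c ∷ swapW w)
τd g w = g (a ∷ b ∷ w) + g (a ∷ c ∷ swapW w)
τcd g w = g (a ∷ a ∷ b ∷ w) + g (a ∷ a ∷ c ∷ swapW w)

-- The block L_j is c at odd and d at even positions j.
τ : Bool → (Word → ℚ) → Word → ℚ
τ true = τc
τ false = τd

τ-cong : ∀ t {f g} → (∀ u → f u ≡ g u) → ∀ w → τ t f w ≡ τ t g w
τ-cong true e w = e _
τ-cong false e w = cong₂ _+_ (e _) (e _)

τ-+ : ∀ t f g w → τ t (λ u → f u + g u) w ≡ τ t f w + τ t g w
τ-+ true f g w = refl
τ-+ false f g w = solve 4 (λ x y z t → (x :+ y) :+ (z :+ t) := (x :+ z) :+ (y :+ t)) refl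
  (f (a ∷ b ∷ w)) (g (a ∷ b ∷ w)) (f (a ∷ c ∷ swapW w)) (g (a ∷ c ∷ swapW w))

-- chain s i g pairs g with x_{s(i-1)}·M(x_{s(i-2)}·M(⋯ x_{s 0}·M(𝟏))), where x_t is
-- the block sum selected by τ t: an element built from i twisted prefixes.
chain : (ℕ → Bool) → ℕ → (Word → ℚ) → ℚ
chain s zero g = g []
chain s (suc i) g = chain s i (τ (s i) g)

chain-cong : ∀ s i {f g} → (∀ u → f u ≡ g u) → chain s i f ≡ chain s i g
chain-cong s zero e = e []
chain-cong s (suc i) e = chain-cong s i (τ-cong (s i) e)

chain-+ : ∀ s i f g → chain s i (λ u → f u + g u) ≡ chain s i f + chain s i g
chain-+ s zero f g = refl
chain-+ s (suc i) f g = trans (chain-cong s i (τ-+ (s i) f g)) (chain-+ s i (τ (s i) f) (τ (s i) g))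

τ-chain : ∀ t s r (G : Word → Word → ℚ) w →
  τ t (λ u → chain s r (G u)) w ≡ chain s r (λ v → τ t (λ u → G u v) w)
τ-chain true s r G w = refl
τ-chain false s r G w = sym (chain-+ s r (G (a ∷ b ∷ w)) (G (a ∷ c ∷ swapW w)))

chain²-+ : ∀ s s' i r (F G : Word → Word → ℚ) →
  chain s i (λ w → chain s' r (λ v → F w v + G w v))
  ≡ chain s i (λ w → chain s' r (F w)) + chain s i (λ w → chain s' r (G w))
chain²-+ s s' i r F G = trans (chain-cong s i (λ w → chain-+ s' r (F w) (G w))) (chain-+ s i _ _)

-- Pchain i is the pairing with P_i (block c at odd positions) and Schain r with a
-- suffix S of r blocks (block c at odd distance from the end); see pair-P, pair-S.
Pchain Schain : ℕ → (Word → ℚ) → ℚ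
Pchain = chain (λ k → odd (suc k))
Schain = chain odd

-- PS i r h is ⟪ P_i ✱ S ∣ h ⟫ for a suffix S of r blocks, by bilinearity (pair-P✱S).
PS : ℕ → ℕ → (Word → ℚ) → ℚ
PS i r h = Pchain i (λ u → Schain r (λ v → ⟪ u ✶ v ∣ h ⟫))

regroup : ∀ x₁ x₂ x₃ y₁ y₂ y₃ → (x₁ + (x₂ + x₃)) + (y₁ + (y₂ + y₃)) ≡ (x₁ + y₁) + (x₂ + y₂) + (y₃ + x₃)
regroup = solve 6 (λ x₁ x₂ x₃ y₁ y₂ y₃ →
  (x₁ :+ (x₂ :+ x₃)) :+ (y₁ :+ (y₂ :+ y₃)) := (x₁ :+ y₁) :+ (x₂ :+ y₂) :+ (y₃ :+ x₃)) refl

-- Transposed stuffle recursion when one word starts with c and the other with a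
-- block of d: remove the first block of the left word, of the right word, or
-- merge both into a block of a²(b+c).
dual-step : ∀ {x} t → x ≡ not t → ∀ w v h →
  τ x (λ u → τ t (λ v' → ⟪ u ✶ v' ∣ h ⟫) v) w
  ≡ τ t (λ v' → ⟪ w ✶ v' ∣ τ x h ⟫) v + τ x (λ u → ⟪ u ✶ v ∣ τ t h ⟫) w + ⟪ w ✶ v ∣ τcd h ⟫
dual-step true refl w v h =
  trans (cong₂ _+_ (unfold-ab-c w v h) (unfold-ac-c w v h))
  (trans (regroup x₁ x₂ x₃ y₁ y₂ y₃)
    (cong₂ _+_ (cong (_+ (x₂ + y₂)) (sym (pair-+ (stW w (c ∷ swapW v)) hab hac)))
               (sym (pair-+ (stW w v) haab haac))))
  where
  hab hac haab haac : Word → ℚ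
  hab t = h (a ∷ b ∷ t)
  hac t = h (a ∷ c ∷ swapW t)
  haab t = h (a ∷ a ∷ b ∷ t)
  haac t = h (a ∷ a ∷ c ∷ swapW t)
  x₁ x₂ x₃ y₁ y₂ y₃ : ℚ
  x₁ = ⟪ w ✶ c ∷ swapW v ∣ hab ⟫
  x₂ = ⟪ a ∷ b ∷ w ✶ v ∣ τc h ⟫
  x₃ = ⟪ w ✶ v ∣ haac ⟫
  y₁ = ⟪ w ✶ c ∷ swapW v ∣ hac ⟫
  y₂ = ⟪ a ∷ c ∷ swapW w ✶ v ∣ τc h ⟫
  y₃ = ⟪ w ✶ v ∣ haab ⟫
dual-step false refl w v h =
  trans (cong₂ _+_ (unfold-c-ab w v h) (unfold-c-ac w v h))
  (trans (regroup x₁ x₂ x₃ y₁ y₂ y₃)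
    (cong₂ _+_ (cong ((x₁ + y₁) +_) (sym (pair-+ (stW (c ∷ swapW w) v) hab hac)))
               (sym (pair-+ (stW w v) haab haac))))
  where
  hab hac haab haac : Word → ℚ
  hab t = h (a ∷ b ∷ t)
  hac t = h (a ∷ c ∷ swapW t)
  haab t = h (a ∷ a ∷ b ∷ t)
  haac t = h (a ∷ a ∷ c ∷ swapW t)
  x₁ x₂ x₃ y₁ y₂ y₃ : ℚ
  x₁ = ⟪ w ✶ a ∷ b ∷ v ∣ τc h ⟫
  x₂ = ⟪ c ∷ swapW w ✶ v ∣ hab ⟫
  x₃ = ⟪ w ✶ v ∣ haac ⟫
  y₁ = ⟪ w ✶ a ∷ c ∷ swapW v ∣ τc h ⟫
  y₂ = ⟪ c ∷ swapW w ✶ v ∣ hac ⟫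
  y₃ = ⟪ w ✶ v ∣ haab ⟫

-- The transposed stuffle recursion for P_i ✱ S_r (the parities match since i + r is even).
PS-rec : ∀ i r h → odd i ≡ odd r →
  PS (suc i) (suc r) h ≡ PS i (suc r) (τ (odd (suc i)) h) + PS (suc i) r (τ (odd r) h) + PS i r (τcd h)
PS-rec i r h e =
  begin
    PS (suc i) (suc r) h
  ≡⟨ chain-cong oddP i (τ-cong x (λ u → refl)) ⟩
    Pchain i (τ x (λ u → Schain r (τ t (λ v' → ⟪ u ✶ v' ∣ h ⟫))))
  ≡⟨ chain-cong oddP i (τ-chain x odd r _) ⟩
    Pchain i (λ w → Schain r (λ v → τ x (λ u → τ t (λ v' → ⟪ u ✶ v' ∣ h ⟫) v) w))
  ≡⟨ chain-cong oddP i (λ w → chain-cong odd r (λ v → dual-step t x≡not-t w v h)) ⟩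
    Pchain i (λ w → Schain r (λ v → A w v + B w v + ⟪ w ✶ v ∣ τcd h ⟫))
  ≡⟨ trans (chain²-+ oddP odd i r _ _) (cong (_+ PS i r (τcd h)) (chain²-+ oddP odd i r A B)) ⟩
    PS i (suc r) (τ x h) + Pchain i (λ w → Schain r (B w)) + PS i r (τcd h)
  ≡⟨ cong (λ z → PS i (suc r) (τ x h) + z + PS i r (τcd h))
          (chain-cong oddP i (λ w → sym (τ-chain x odd r (λ u v → ⟪ u ✶ v ∣ τ t h ⟫) w))) ⟩
    PS i (suc r) (τ x h) + PS (suc i) r (τ t h) + PS i r (τcd h)
  ∎
  where
  open ≡-Reasoning
  oddP : ℕ → Bool
  oddP k = odd (suc k)
  x t : Bool
  x = odd (suc i)
  t = odd r
  x≡not-t : x ≡ not t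
  x≡not-t = trans (odd-suc i) (cong not e)
  A B : Word → Word → ℚ
  A w v = τ t (λ v' → ⟪ w ✶ v' ∣ τ x h ⟫) v
  B w v = τ x (λ u → ⟪ u ✶ v ∣ τ t h ⟫) w

-- Boundary values: stuffling with the empty word is the identity.
PS-left-empty : ∀ r h → PS 0 (suc r) h ≡ PS 0 r (τ (odd r) h)
PS-left-empty r h =
  chain-cong odd r (λ w → trans (τ-cong (odd r) (λ v → pair-word v h) w) (sym (pair-word w (τ (odd r) h))))

PS-right-empty : ∀ i h → PS (suc i) 0 h ≡ PS i 0 (τ (odd (suc i)) h)
PS-right-empty i h = chain-cong (λ k → odd (suc k)) i (λ w →
  trans (τ-cong (odd (suc i)) (λ u → stuffle-nil u h) w) (sym (stuffle-nil w (τ (odd (suc i)) h))))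
  where
  stuffle-nil : ∀ u g → ⟪ u ✶ [] ∣ g ⟫ ≡ g u
  stuffle-nil u g = trans (cong ⟪_∣ g ⟫ (stW-nil u)) (pair-word u g)

sumℚ : ℕ → (ℕ → ℚ) → ℚ
sumℚ zero f = f 0
sumℚ (suc m) f = sumℚ m f + f (suc m)

sumBelow : ℕ → (ℕ → ℚ) → ℚ
sumBelow zero f = 0ℚ
sumBelow (suc t) f = sumBelow t f + f t

sumBelow-sumℚ : ∀ m f → sumBelow (suc m) f ≡ sumℚ m f
sumBelow-sumℚ zero f = ℚP.+-identityˡ (f 0)
sumBelow-sumℚ (suc m) f = cong (_+ f (suc m)) (sumBelow-sumℚ m f)

sumℚ-cong : ∀ m f g → (∀ i → i ≤ m → f i ≡ g i) → sumℚ m f ≡ sumℚ m g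
sumℚ-cong zero f g e = e 0 z≤n
sumℚ-cong (suc m) f g e = cong₂ _+_ (sumℚ-cong m f g (λ i le → e i (ℕP.m≤n⇒m≤1+n le))) (e (suc m) ℕP.≤-refl)

sumℚ-neg : ∀ m f → sumℚ m (λ j → - f j) ≡ - sumℚ m f
sumℚ-neg zero f = refl
sumℚ-neg (suc m) f = trans (cong (_+ - f (suc m)) (sumℚ-neg m f)) (sym (ℚP.neg-distrib-+ (sumℚ m f) (f (suc m))))

telescope : ∀ K (x A B : ℕ → ℚ) → x 0 ≡ A 1 → x (suc (suc K)) ≡ A (suc (suc K)) →
  (∀ j → j ≤ K → x (suc j) ≡ A (suc j) + A (suc (suc j)) + B (suc j)) →
  sumℚ (suc (suc K)) (λ i → sgn i * x i) ≡ - sumℚ K (λ j → sgn j * B (suc j))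
telescope K x A B first last middle =
  begin
    sumℚ (suc (suc K)) (λ i → sgn i * x i)
  ≡⟨ cong₂ (λ u v → u + sgn (suc (suc K)) * v) (partial (suc K) ℕP.≤-refl) last ⟩
    (Bsum (suc K) + sgn (suc K) * A (suc (suc K))) + sgn (suc (suc K)) * A (suc (suc K))
  ≡⟨ solve 3 (λ S s y → (S :+ (:- s) :* y) :+ (:- (:- s)) :* y := S) refl (Bsum (suc K)) (sgn K) (A (suc (suc K))) ⟩
    Bsum (suc K)
  ≡⟨ sumBelow-sumℚ K _ ⟩
    sumℚ K (λ j → - sgn j * B (suc j))
  ≡⟨ sumℚ-cong K _ _ (λ j _ → sym (ℚP.neg-distribˡ-* (sgn j) (B (suc j)))) ⟩
    sumℚ K (λ j → - (sgn j * B (suc j)))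
  ≡⟨ sumℚ-neg K (λ j → sgn j * B (suc j)) ⟩
    - sumℚ K (λ j → sgn j * B (suc j))
  ∎
  where
  open ≡-Reasoning
  Bsum : ℕ → ℚ
  Bsum t = sumBelow t (λ j → sgn (suc j) * B (suc j))
  partial : ∀ t → t ≤ suc K → sumℚ t (λ i → sgn i * x i) ≡ Bsum t + sgn t * A (suc t)
  partial zero le = trans (cong (1ℚ *_) first) (sym (ℚP.+-identityˡ _))
  partial (suc t) (s≤s le) =
    trans (cong₂ (λ u v → u + sgn (suc t) * v) (partial t (ℕP.m≤n⇒m≤1+n le)) (middle t le))
      (solve 5 (λ S s y y' z → (S :+ s :* y) :+ (:- s) :* (y :+ y' :+ z) := (S :+ (:- s) :* z) :+ (:- s) :* y') refl
        (Bsum t) (sgn t) (A (suc t)) (A (suc (suc t))) (B (suc t)))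

alt : ℕ → (Word → ℚ) → ℚ
alt N h = sumℚ N (λ i → sgn i * PS i (N ∸ i) h)

-- Main reduction: by the transposed stuffle recursion the alternating sum telescopes;
-- only the bracket terms survive, which form the alternating sum two steps shorter.
alt-step : ∀ K h → odd K ≡ false → alt (suc (suc K)) h ≡ - alt K (τcd h)
alt-step K h even-K = telescope K x A B first last middle
  where
  N : ℕ
  N = suc (suc K)
  x A B : ℕ → ℚ
  x i = PS i (N ∸ i) h
  A i = PS (pred i) (N ∸ i) (τ (odd i) h)
  B i = PS (pred i) (N ∸ suc i) (τcd h)
  first : x 0 ≡ A 1
  first = trans (PS-left-empty (suc K) h) (cong (λ t → PS 0 (suc K) (τ t h)) (trans (odd-suc K) (cong not even-K)))
  last : x N ≡ A N
  last rewrite ℕP.n∸n≡0 K = PS-right-empty (suc K) h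
  middle : ∀ j → j ≤ K → x (suc j) ≡ A (suc j) + A (suc (suc j)) + B (suc j)
  middle j le rewrite ℕP.+-∸-assoc 1 le =
    trans (PS-rec j (K ∸ j) h same)
      (cong (λ t → PS j (suc (K ∸ j)) (τ (odd (suc j)) h) + PS (suc j) (K ∸ j) (τ t h) + PS j (K ∸ j) (τcd h))
            (sym (trans (odd-ss j) same)))
    where
    same : odd j ≡ odd (K ∸ j)
    same = same-parity j (K ∸ j) (trans (cong odd (ℕP.m+[n∸m]≡n le)) even-K)

-- powPair x y k g = Σ_{w ∈ {x,y}^k} g(w), the pairing of g with (x + y)^k.
powPair : Word → Word → ℕ → (Word → ℚ) → ℚ
powPair x y zero g = g []
powPair x y (suc k) g = powPair x y k (λ w → g (x ++ w)) + powPair x y k (λ w → g (y ++ w))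

powPair-cong : ∀ x y k {f g} → (∀ u → f u ≡ g u) → powPair x y k f ≡ powPair x y k g
powPair-cong x y zero e = e []
powPair-cong x y (suc k) e = cong₂ _+_ (powPair-cong x y k (λ w → e (x ++ w))) (powPair-cong x y k (λ w → e (y ++ w)))

powPair-+ : ∀ x y k f g → powPair x y k (λ u → f u + g u) ≡ powPair x y k f + powPair x y k g
powPair-+ x y zero f g = refl
powPair-+ x y (suc k) f g = trans (cong₂ _+_ (powPair-+ x y k _ _) (powPair-+ x y k _ _))
  (solve 4 (λ p q r s → (p :+ q) :+ (r :+ s) := (p :+ r) :+ (q :+ s)) refl
    (powPair x y k (λ w → f (x ++ w))) (powPair x y k (λ w → g (x ++ w)))
    (powPair x y k (λ w → f (y ++ w))) (powPair x y k (λ w → g (y ++ w))))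

powPair-swap : ∀ x y → swapW x ≡ y → swapW y ≡ x → ∀ k g → powPair x y k (λ w → g (swapW w)) ≡ powPair x y k g
powPair-swap x y ex ey zero g = refl
powPair-swap x y ex ey (suc k) g =
  trans (cong₂ _+_
          (trans (powPair-cong x y k (λ w → cong g (trans (swap-++ x w) (cong (_++ swapW w) ex))))
                 (powPair-swap x y ex ey k (λ w → g (y ++ w))))
          (trans (powPair-cong x y k (λ w → cong g (trans (swap-++ y w) (cong (_++ swapW w) ey))))
                 (powPair-swap x y ex ey k (λ w → g (x ++ w)))))
        (ℚP.+-comm (powPair x y k (λ w → g (y ++ w))) (powPair x y k (λ w → g (x ++ w))))

aab aac abc acb ab ac : Word
aab = a ∷ a ∷ b ∷ []
aac = a ∷ a ∷ c ∷ []
abc = a ∷ b ∷ c ∷ []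
acb = a ∷ c ∷ b ∷ []
ab = a ∷ b ∷ []
ac = a ∷ c ∷ []

pair-power : ∀ n g → ⟪ a²[b+c] ^· n ∣ g ⟫ ≡ powPair aab aac n g
pair-power zero g = pair-word [] g
pair-power (suc n) g =
  trans (pair-· a²[b+c] (a²[b+c] ^· n) g)
  (trans (pair-two aab aac (λ u → ⟪ a²[b+c] ^· n ∣ (λ v → g (u ++ v)) ⟫))
         (cong₂ _+_ (pair-power n (λ w → g (aab ++ w))) (pair-power n (λ w → g (aac ++ w)))))

τcd-power : ∀ n h → powPair aab aac n (τcd h) ≡ powPair aab aac (suc n) h
τcd-power n h = trans (powPair-+ aab aac n _ _)
  (cong (powPair aab aac n (λ w → h (aab ++ w)) +_) (powPair-swap aab aac refl refl n (λ w → h (aac ++ w))))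

alt-closed : ∀ n h → alt (n +ℕ n) h ≡ sgn n * powPair aab aac n h
alt-closed zero h = cong (1ℚ *_) (pair-word [] h)
alt-closed (suc n) h =
  begin
    alt (suc n +ℕ suc n) h
  ≡⟨ cong (λ m → alt (suc m) h) (ℕP.+-suc n n) ⟩
    alt (suc (suc (n +ℕ n))) h
  ≡⟨ alt-step (n +ℕ n) h (odd-double n) ⟩
    - alt (n +ℕ n) (τcd h)
  ≡⟨ cong -_ (alt-closed n (τcd h)) ⟩
    - (sgn n * powPair aab aac n (τcd h))
  ≡⟨ ℚP.neg-distribˡ-* (sgn n) _ ⟩
    - sgn n * powPair aab aac n (τcd h)
  ≡⟨ cong (- sgn n *_) (τcd-power n h) ⟩
    sgn (suc n) * powPair aab aac (suc n) h
  ∎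
  where open ≡-Reasoning

-- E = d ⋆ c = abc + acb; powE k pairs with E^k.
powE : ℕ → (Word → ℚ) → ℚ
powE = powPair abc acb

powE-swap : ∀ k g → powE k (λ w → g (swapW w)) ≡ powE k g
powE-swap = powPair-swap abc acb refl refl

-- ⋆-concatenation only differs from concatenation at a junction b|b or c|c.
starW-a : ∀ u v → starW u (a ∷ v) ≡ u ++ a ∷ v
starW-a u v with lastL u
... | just a = refl
... | just b = refl
... | just c = refl
... | nothing = refl

lastL-after : ∀ u x y → lastL (u ++ x ∷ y ∷ []) ≡ just y
lastL-after [] x y = refl
lastL-after (z ∷ []) x y = refl
lastL-after (z ∷ z' ∷ u) x y = lastL-after (z' ∷ u) x y

starW-ab-c : ∀ u → starW (u ++ ab) (c ∷ []) ≡ u ++ abc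
starW-ab-c u rewrite lastL-after u a b = ++-assoc u ab (c ∷ [])

starW-ac-c : ∀ u → starW (u ++ ac) (c ∷ []) ≡ u ++ acb
starW-ac-c u rewrite lastL-after u a c = ++-assoc u ac (b ∷ [])

pair-⋆c : ∀ X g → ⟪ X ⋆ cP ∣ g ⟫ ≡ ⟪ X ∣ (λ u → g (starW u (c ∷ []))) ⟫
pair-⋆c X g = trans (pair-⋆ X cP g) (pair-cong X (λ u → pair-word (c ∷ []) (λ v → g (starW u v))))

pair-⋆d : ∀ X g → ⟪ X ⋆ dP ∣ g ⟫ ≡ ⟪ X ∣ (λ u → g (u ++ ab) + g (u ++ ac)) ⟫
pair-⋆d X g = trans (pair-⋆ X dP g) (pair-cong X (λ u →
  trans (pair-two ab ac (λ v → g (starW u v))) (cong₂ _+_ (cong g (starW-a u (b ∷ []))) (cong g (starW-a u (c ∷ []))))))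

pair-⋆dc : ∀ X g → ⟪ (X ⋆ dP) ⋆ cP ∣ g ⟫ ≡ ⟪ X ∣ (λ u → g (u ++ abc) + g (u ++ acb)) ⟫
pair-⋆dc X g =
  trans (pair-⋆c (X ⋆ dP) g)
  (trans (pair-⋆d X (λ u → g (starW u (c ∷ []))))
         (pair-cong X (λ u → cong₂ _+_ (cong g (starW-ab-c u)) (cong g (starW-ac-c u)))))

dcBlocks cdBlocks : ℕ → List Poly
dcBlocks zero = []
dcBlocks (suc k) = dP ∷ cP ∷ dcBlocks k
cdBlocks zero = []
cdBlocks (suc k) = cP ∷ dP ∷ cdBlocks k

fold-dc : ∀ k X g → ⟪ foldl _⋆_ X (dcBlocks k) ∣ g ⟫ ≡ ⟪ X ∣ (λ u → powE k (λ v → g (u ++ v))) ⟫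
fold-dc zero X g = pair-cong X (λ u → cong g (sym (++-identityʳ u)))
fold-dc (suc k) X g =
  trans (fold-dc k ((X ⋆ dP) ⋆ cP) g)
  (trans (pair-⋆dc X _)
   (pair-cong X (λ u → cong₂ _+_ (powPair-cong abc acb k (λ v → cong g (++-assoc u abc v)))
                                  (powPair-cong abc acb k (λ v → cong g (++-assoc u acb v))))))

-- If X = Y · (ab + ac) (it ends with the block d), then X ⋆ (c ⋆ d)^{⋆j} = Y · E^j · (ab + ac).
fold-cd : ∀ j X Y → (∀ f → ⟪ X ∣ f ⟫ ≡ ⟪ Y ∣ (λ u → f (u ++ ab) + f (u ++ ac)) ⟫) →
  ∀ g → ⟪ foldl _⋆_ X (cdBlocks j) ∣ g ⟫ ≡ ⟪ Y ∣ (λ u → powE j (λ v → g (u ++ v ++ ab) + g (u ++ v ++ ac))) ⟫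
fold-cd zero X Y ends-d g = ends-d g
fold-cd (suc j) X Y ends-d g =
  trans (fold-cd j ((X ⋆ cP) ⋆ dP) (Y · Epoly) ends-d' g)
  (trans (pair-· Y Epoly G)
   (pair-cong Y (λ u → trans (pair-two abc acb (λ v → G (u ++ v)))
     (cong₂ _+_ (powPair-cong abc acb j (λ v → cong₂ _+_ (cong g (++-assoc u abc (v ++ ab))) (cong g (++-assoc u abc (v ++ ac)))))
                (powPair-cong abc acb j (λ v → cong₂ _+_ (cong g (++-assoc u acb (v ++ ab))) (cong g (++-assoc u acb (v ++ ac)))))))))
  where
  Epoly : Poly
  Epoly = (1ℚ , abc) ∷ (1ℚ , acb) ∷ []
  G : Word → ℚ
  G t = powE j (λ v → g (t ++ v ++ ab) + g (t ++ v ++ ac))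
  endD : (Word → ℚ) → Word → ℚ
  endD f t = f (t ++ ab) + f (t ++ ac)
  ends-d' : ∀ f → ⟪ (X ⋆ cP) ⋆ dP ∣ f ⟫ ≡ ⟪ Y · Epoly ∣ endD f ⟫
  ends-d' f =
    trans (pair-⋆d (X ⋆ cP) f)
    (trans (pair-⋆c X (endD f))
    (trans (ends-d (λ u → endD f (starW u (c ∷ []))))
    (trans (pair-cong Y (λ u → cong₂ _+_ (cong (endD f) (starW-ab-c u)) (cong (endD f) (starW-ac-c u))))
     (sym (trans (pair-· Y Epoly (endD f)) (pair-cong Y (λ u → pair-two abc acb (λ v → endD f (u ++ v)))))))))

range-parity : ∀ {s s'} l → odd s ≡ odd s' → range s l ≡ range s' l
range-parity zero e = refl
range-parity {s} {s'} (suc l) e =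
  cong₂ _∷_ (cong (λ t → if t then cP else dP) e)
            (range-parity l (trans (odd-suc s) (trans (cong not e) (sym (odd-suc s')))))

range-1 : ∀ k → range 1 (k +ℕ k) ≡ cdBlocks k
range-1 zero = refl
range-1 (suc k) rewrite ℕP.+-suc k k = cong (λ z → cP ∷ dP ∷ z) (trans (range-parity (k +ℕ k) refl) (range-1 k))

range-2 : ∀ k → range 2 (k +ℕ k) ≡ dcBlocks k
range-2 zero = refl
range-2 (suc k) rewrite ℕP.+-suc k k = cong (λ z → dP ∷ cP ∷ z) (trans (range-parity (k +ℕ k) refl) (range-2 k))

reverse-cd : ∀ k → reverse (cdBlocks k) ≡ dcBlocks k
reverse-cd zero = refl
reverse-cd (suc k) =
  trans (unfold-reverse cP (dP ∷ cdBlocks k))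
  (trans (cong (_∷ʳ cP) (unfold-reverse dP (cdBlocks k)))
  (trans (cong (λ z → (z ∷ʳ dP) ∷ʳ cP) (reverse-cd k))
  (trans (++-assoc (dcBlocks k) (dP ∷ []) (cP ∷ [])) (dc-snoc k))))
  where
  dc-snoc : ∀ k → dcBlocks k ++ dP ∷ cP ∷ [] ≡ dP ∷ cP ∷ dcBlocks k
  dc-snoc zero = refl
  dc-snoc (suc k) = cong (λ z → dP ∷ cP ∷ z) (dc-snoc k)

pair-P-even : ∀ k g → ⟪ P (k +ℕ k) ∣ g ⟫ ≡ powE k g
pair-P-even k g =
  trans (cong (λ t → ⟪ (if t then ⋆prod (range 1 (k +ℕ k)) else ⋆prod (reverse (range 1 (k +ℕ k)))) ∣ g ⟫) (odd-double k))
  (trans (cong (λ z → ⟪ ⋆prod (reverse z) ∣ g ⟫) (range-1 k))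
  (trans (cong (λ z → ⟪ ⋆prod z ∣ g ⟫) (reverse-cd k)) (dc-product k)))
  where
  dc-product : ∀ k → ⟪ ⋆prod (dcBlocks k) ∣ g ⟫ ≡ powE k g
  dc-product zero = pair-word [] g
  dc-product (suc k) = trans (fold-dc k (dP ⋆ cP) g)
    (trans (pair-⋆ dP cP G)
    (trans (pair-two ab ac (λ u → ⟪ cP ∣ (λ v → G (starW u v)) ⟫))
           (cong₂ _+_ (pair-word (c ∷ []) (λ v → G (starW ab v))) (pair-word (c ∷ []) (λ v → G (starW ac v))))))
    where
    G : Word → ℚ
    G u = powE k (λ v → g (u ++ v))

pair-P-odd : ∀ k g → ⟪ P (suc (k +ℕ k)) ∣ g ⟫ ≡ powE k (λ v → g (c ∷ v))
pair-P-odd k g =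
  trans (cong (λ t → ⟪ (if t then ⋆prod (range 1 (suc (k +ℕ k))) else ⋆prod (reverse (range 1 (suc (k +ℕ k))))) ∣ g ⟫) (odd-2k+1 k))
  (trans (cong (λ z → ⟪ ⋆prod (cP ∷ z) ∣ g ⟫) (range-2 k))
  (trans (fold-dc k cP g) (pair-word (c ∷ []) (λ u → powE k (λ v → g (u ++ v))))))

-- The chains give the same closed forms, using that E^k is swap-invariant.
Pchain-even : ∀ k g → Pchain (k +ℕ k) g ≡ powE k g
Pchain-odd : ∀ k g → Pchain (suc (k +ℕ k)) g ≡ powE k (λ v → g (c ∷ v))
Pchain-odd k g =
  trans (cong (λ t → Pchain (k +ℕ k) (τ t g)) (odd-2k+1 k))
  (trans (Pchain-even k (τc g)) (powE-swap k (λ w → g (c ∷ w))))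
Pchain-even zero g = refl
Pchain-even (suc k) g =
  trans (cong (λ m → Pchain (suc m) g) (ℕP.+-suc k k))
  (trans (cong (λ t → Pchain (suc (k +ℕ k)) (τ t g)) (odd-2k+2 k))
  (trans (Pchain-odd k (τd g))
  (trans (powPair-+ abc acb k _ _)
         (cong (powE k (λ w → g (abc ++ w)) +_) (powE-swap k (λ w → g (acb ++ w)))))))

pair-P : ∀ i g → ⟪ P i ∣ g ⟫ ≡ Pchain i g
pair-P i g with even-or-odd i
... | k , inj₁ refl = trans (pair-P-even k g) (sym (Pchain-even k g))
... | k , inj₂ refl = trans (pair-P-odd k g) (sym (Pchain-odd k g))

-- The last r blocks L_{r+1} ⋯ L_{2r} (up to parity, the suffix S_i with r = 2n - i).
suffixBlocks : ℕ → List Poly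
suffixBlocks r = range (suc r) r

pair-suffix-odd : ∀ j g → ⟪ ⋆prod (suffixBlocks (suc (j +ℕ j))) ∣ g ⟫ ≡ powE j (λ v → g (v ++ ab) + g (v ++ ac))
pair-suffix-odd j g =
  trans (cong (λ z → ⟪ ⋆prod z ∣ g ⟫)
              (trans (range-parity {s' = 2} (suc (j +ℕ j)) (odd-2k+2 j)) (cong (dP ∷_) (trans (range-parity {3} {1} (j +ℕ j) refl) (range-1 j)))))
  (trans (fold-cd j dP one ends-d g)
         (pair-word [] (λ u → powE j (λ v → g (u ++ v ++ ab) + g (u ++ v ++ ac)))))
  where
  ends-d : ∀ f → ⟪ dP ∣ f ⟫ ≡ ⟪ one ∣ (λ u → f (u ++ ab) + f (u ++ ac)) ⟫
  ends-d f = trans (pair-two ab ac f) (sym (pair-word [] (λ u → f (u ++ ab) + f (u ++ ac))))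

pair-suffix-even : ∀ j g → ⟪ ⋆prod (suffixBlocks (suc (suc (j +ℕ j)))) ∣ g ⟫ ≡ powE j (λ v → g (c ∷ v ++ ab) + g (c ∷ v ++ ac))
pair-suffix-even j g =
  trans (cong (λ z → ⟪ ⋆prod z ∣ g ⟫)
              (trans (range-parity {s' = 1} (suc (suc (j +ℕ j))) (trans (odd-ss (suc (j +ℕ j))) (odd-2k+1 j)))
                     (cong (λ z → cP ∷ dP ∷ z) (trans (range-parity {3} {1} (j +ℕ j) refl) (range-1 j)))))
  (trans (fold-cd j (cP ⋆ dP) cP (pair-⋆d cP) g)
         (pair-word (c ∷ []) (λ u → powE j (λ v → g (u ++ v ++ ab) + g (u ++ v ++ ac)))))

Schain-odd : ∀ j g → Schain (suc (j +ℕ j)) g ≡ powE j (λ v → g (v ++ ab) + g (v ++ ac))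
Schain-odd zero g = refl
Schain-odd (suc j) g =
  trans (cong (λ m → Schain (suc (suc m)) g) (ℕP.+-suc j j))
  (trans (cong₂ (λ t t' → Schain (suc (j +ℕ j)) (τ t (τ t' g))) (odd-2k+1 j) (odd-2k+2 j))
  (trans (Schain-odd j (τc (τd g)))
  (trans (powPair-cong abc acb j split-ends)
  (trans (powPair-+ abc acb j F₁ F₂)
   (cong (_+ powE j F₂)
     (trans (powE-swap j F₁')
            (powPair-cong abc acb j (λ w → ℚP.+-comm (g (abc ++ w ++ ac)) (g (abc ++ w ++ ab))))))))))
  where
  F₁ F₁' F₂ : Word → ℚ
  F₁ w = g (abc ++ swapW w ++ ac) + g (abc ++ swapW w ++ ab)
  F₁' w = g (abc ++ w ++ ac) + g (abc ++ w ++ ab)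
  F₂ w = g (acb ++ w ++ ab) + g (acb ++ w ++ ac)
  split-ends : ∀ v → τc (τd g) (v ++ ab) + τc (τd g) (v ++ ac) ≡ F₁ v + F₂ v
  split-ends v =
    trans (cong₂ _+_
       (cong₂ _+_ (cong (λ z → g (abc ++ z)) (swap-++ v ab)) (cong (λ z → g (acb ++ z)) (swap-inv (v ++ ab))))
       (cong₂ _+_ (cong (λ z → g (abc ++ z)) (swap-++ v ac)) (cong (λ z → g (acb ++ z)) (swap-inv (v ++ ac)))))
     (solve 4 (λ x y z t → (x :+ y) :+ (z :+ t) := (x :+ z) :+ (y :+ t)) refl
        (g (abc ++ swapW v ++ ac)) (g (acb ++ v ++ ab)) (g (abc ++ swapW v ++ ab)) (g (acb ++ v ++ ac)))

Schain-even : ∀ j g → Schain (suc (suc (j +ℕ j))) g ≡ powE j (λ v → g (c ∷ v ++ ab) + g (c ∷ v ++ ac))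
Schain-even j g =
  trans (cong (λ t → Schain (suc (j +ℕ j)) (τ t g)) (odd-2k+1 j))
  (trans (Schain-odd j (τc g))
  (trans (powPair-cong abc acb j (λ v → cong₂ _+_ (cong (λ z → g (c ∷ z)) (swap-++ v ab)) (cong (λ z → g (c ∷ z)) (swap-++ v ac))))
  (trans (powE-swap j (λ w → g (c ∷ w ++ ac) + g (c ∷ w ++ ab)))
         (powPair-cong abc acb j (λ w → ℚP.+-comm (g (c ∷ w ++ ac)) (g (c ∷ w ++ ab)))))))

pair-suffix : ∀ r g → ⟪ ⋆prod (suffixBlocks r) ∣ g ⟫ ≡ Schain r g
pair-suffix r g with even-or-odd r
pair-suffix r g | zero , inj₁ refl = pair-word [] g
pair-suffix r g | suc j , inj₁ refl rewrite ℕP.+-suc j j = trans (pair-suffix-even j g) (sym (Schain-even j g))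
pair-suffix r g | j , inj₂ refl = trans (pair-suffix-odd j g) (sym (Schain-odd j g))

-- ⟪ S_i ∣ g ⟫ is the chain Schain (2n - i) g, as i and 2n - i have the same parity.
pair-S : ∀ m i → odd m ≡ false → i ≤ m → ∀ g → ⟪ S m i ∣ g ⟫ ≡ Schain (m ∸ i) g
pair-S m i even-m i≤m g =
  trans (cong (λ z → ⟪ ⋆prod z ∣ g ⟫) (range-parity (m ∸ i) (trans (odd-suc i) (trans (cong not same) (sym (odd-suc (m ∸ i)))))))
        (pair-suffix (m ∸ i) g)
  where
  same : odd i ≡ odd (m ∸ i)
  same = same-parity i (m ∸ i) (trans (cong odd (ℕP.m+[n∸m]≡n i≤m)) even-m)

pair-sumP : ∀ m F h → ⟪ sumP m F ∣ h ⟫ ≡ sumℚ m (λ i → ⟪ F i ∣ h ⟫)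
pair-sumP zero F h = refl
pair-sumP (suc m) F h = trans (pair-⊕ (sumP m F) (F (suc m)) h) (cong (_+ ⟪ F (suc m) ∣ h ⟫) (pair-sumP m F h))

pair-P✱S : ∀ m i → odd m ≡ false → i ≤ m → ∀ h → ⟪ P i ✱ S m i ∣ h ⟫ ≡ PS i (m ∸ i) h
pair-P✱S m i even-m i≤m h =
  trans (pair-bilin stW (P i) (S m i) h)
  (trans (pair-P i _)
         (chain-cong (λ k → odd (suc k)) i (λ u → pair-S m i even-m i≤m (λ v → ⟪ u ✶ v ∣ h ⟫))))

pair-LHS : ∀ n h → ⟪ LHS n ∣ h ⟫ ≡ alt (n +ℕ n) h
pair-LHS n h =
  trans (pair-sumP (n +ℕ n) _ h)
        (sumℚ-cong (n +ℕ n) _ _ (λ i i≤2n →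
          trans (pair-scale (sgn i) (P i ✱ S (n +ℕ n) i) h)
                (cong (sgn i *_) (pair-P✱S (n +ℕ n) i (odd-double n) i≤2n h))))

pair-RHS : ∀ n h → ⟪ RHS n ∣ h ⟫ ≡ sgn n * powPair aab aac n h
pair-RHS n h = trans (pair-scale (sgn n) (a²[b+c] ^· n) h) (cong (sgn n *_) (pair-power n h))

-- Both sides pair equally with every indicator δ w, hence have the same coefficients.
-- (The identity holds for n = 0 as well.)
mainTheorem3 : (n : ℕ) → n ≥ 1 → LHS n ≈P RHS n
mainTheorem3 n _ w =
  begin
    coeff (LHS n) w
  ≡⟨ coeff-pair (LHS n) w ⟩
    ⟪ LHS n ∣ δ w ⟫
  ≡⟨ pair-LHS n (δ w) ⟩
    alt (n +ℕ n) (δ w)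
  ≡⟨ alt-closed n (δ w) ⟩
    sgn n * powPair aab aac n (δ w)
  ≡⟨ sym (pair-RHS n (δ w)) ⟩
    ⟪ RHS n ∣ δ w ⟫
  ≡⟨ sym (coeff-pair (RHS n) w) ⟩
    coeff (RHS n) w
  ∎
  where open ≡-Reasoning
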